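{- Let $h,w\ge 4$ and let $G=K_w(U)\sqcap K_h$ with $U\subseteq\{1,\dots,w\}$ and $|U|=r\neq w$. Then $Z(G)\le wh-(h+r)$.
   Context: All graphs are finite, simple and undirected. The complete graph $K_n$ has vertex set $\{1,\dots,n\}$ with an edge between every pair of distinct vertices. For graphs $W,H$ and a subset $U\subseteq V(W)$ (the root set), the (generalized) hierarchical product $W(U)\sqcap H$ is the graph with vertex set $V(W)\times V(H)$ in which $(x_1,y_1)$ and $(x_2,y_2)$ are adjacent if and only if either ($x_1=x_2\in U$ and $y_1y_2\in E(H)$) or ($y_1=y_2$ and $x_1x_2\in E(W)$). Zero forcing: starting from a set $S$ of filled vertices, repeatedly apply the color change rule: if a filled vertex has exactly one unfilled neighbor, that neighbor becomes filled. $S$ is a zero forcing set if this eventually fills every vertex. The zero forcing number $Z(G)$ is the minimum size of a zero forcing set of $G$. -}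

module Defs where

open import Data.Nat using (ℕ; _*_; _≤_)
open import Data.Fin using (Fin; remQuot)
open import Data.Fin.Subset using (Subset; _∈_; ∣_∣)
open import Data.Product using (_×_; _,_; ∃-syntax)
open import Data.Sum using (_⊎_)
open import Relation.Binary.PropositionalEquality using (_≡_; _≢_)

KAdj : (n : ℕ) → Fin n → Fin n → Set
KAdj n i j = i ≢ j

HierAdj : {w h : ℕ} → (Fin w → Fin w → Set) → Subset w → (Fin h → Fin h → Set)
        → (Fin w × Fin h) → (Fin w × Fin h) → Set
HierAdj W U H (x₁ , y₁) (x₂ , y₂) =
  (x₁ ≡ x₂ × x₁ ∈ U × H y₁ y₂) ⊎ (y₁ ≡ y₂ × W x₁ x₂)

HierAdjFin : {w h : ℕ} → (Fin w → Fin w → Set) → Subset w → (Fin h → Fin h → Set)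
           → Fin (w * h) → Fin (w * h) → Set
HierAdjFin {w} {h} W U H a b = HierAdj W U H (remQuot h a) (remQuot h b)

-- Vertices filled by repeated application of the color change rule starting from S:
-- v is filled if v ∈ S, or some filled vertex u adjacent to v has all its other
-- neighbours filled (so v is u's unique unfilled neighbour, and u forces v).
data Filled {n : ℕ} (Adj : Fin n → Fin n → Set) (S : Subset n) : Fin n → Set where
  initial : ∀ {v} → v ∈ S → Filled Adj S v
  force   : ∀ {u v} → Filled Adj S u → Adj u v
          → (∀ z → Adj u z → z ≢ v → Filled Adj S z)
          → Filled Adj S v

IsZeroForcingSet : {n : ℕ} → (Fin n → Fin n → Set) → Subset n → Set
IsZeroForcingSet Adj S = ∀ v → Filled Adj S v

ZeroForcingNumber≤ : {n : ℕ} → (Fin n → Fin n → Set) → ℕ → Set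
ZeroForcingNumber≤ {n} Adj k = ∃[ S ] (IsZeroForcingSet Adj S × ∣ S ∣ ≤ k)

-- Let x₀ ∉ U be a non-root column, x₁ ≠ x₀ another column, and leave unfilled the row-0
-- vertices of the columns in U ∪ {x₀} together with the vertices of column x₁ outside row 0,
-- that is h + r vertices. In each row y ≠ 0 the vertex (x₀ , y) has no column neighbours, so it
-- forces (x₁ , y). Each root vertex (x , 0) is then the last unfilled neighbour of (x , 1), and
-- finally (x₁ , 0) forces (x₀ , 0). This needs only w ≥ 2 and h ≥ 2.
module Submission where

open import Defs
open import Data.Nat using (ℕ; suc; _*_; _+_; _∸_; _≤_; s≤s)
open import Data.Nat.Properties using (+-comm; +-mono-≤; *-identityˡ; ∸-monoʳ-≤; ≤-reflexive; module ≤-Reasoning)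
open import Data.Nat.Tactic.RingSolver using (solve-∀)
open import Data.Bool using (Bool)
open import Data.Fin using (Fin; zero; suc; combine; remQuot)
open import Data.Fin.Properties using (remQuot-combine; combine-remQuot; punchInᵢ≢i; ¬∀⟶∃¬; _≟_)
open import Data.Fin.Subset using (Subset; inside; outside; ∣_∣; _∈_; _∉_; _∪_; ⁅_⁆; ∁; _⊂_)
open import Data.Fin.Subset.Properties
  using (_∈?_; ⊆⊤; ⊆-antisym; ∣⊤∣≡n; ∣⁅x⁆∣≡1; ∣∁p∣≡n∸∣p∣; x∉p⇒x∈∁p; x∈p∪q⁻; x∈p∪q⁺; p⊆p∪q; x∈⁅x⁆; x∈⁅y⁆⇒x≡y; p⊂q⇒∣p∣<∣q∣)
open import Data.Vec using ([]; _∷_; _++_; concat; tabulate; replicate; lookup)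
open import Data.Vec.Properties using (lookup-concat; lookup∘tabulate; lookup-replicate; lookup⇒[]=; []=⇒lookup)
open import Data.Product using (_×_; _,_; ∃-syntax; uncurry)
open import Data.Sum using (inj₁; inj₂; [_,_]′)
open import Function using (_∘_)
open import Data.Empty using (⊥-elim)
open import Relation.Nullary using (yes; no)
open import Relation.Binary.PropositionalEquality using (_≡_; _≢_; refl; sym; trans; cong; cong₂; subst; subst₂; module ≡-Reasoning)

∣p∣≢n⇒∃∉p : ∀ {n} (p : Subset n) → ∣ p ∣ ≢ n → ∃[ x ] x ∉ p
∣p∣≢n⇒∃∉p {n} p ∣p∣≢n = ¬∀⟶∃¬ n (_∈ p) (_∈? p)
  λ all∈p → ∣p∣≢n (trans (cong ∣_∣ (⊆-antisym ⊆⊤ (λ {x} _ → all∈p x))) (∣⊤∣≡n n))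

∣p++q∣≡∣p∣+∣q∣ : ∀ {m n} (p : Subset m) (q : Subset n) → ∣ p ++ q ∣ ≡ ∣ p ∣ + ∣ q ∣
∣p++q∣≡∣p∣+∣q∣ []            q = refl
∣p++q∣≡∣p∣+∣q∣ (inside ∷ p)  q = cong suc (∣p++q∣≡∣p∣+∣q∣ p q)
∣p++q∣≡∣p∣+∣q∣ (outside ∷ p) q = ∣p++q∣≡∣p∣+∣q∣ p q

∣replicate∣ : ∀ n (b : Bool) → ∣ replicate n b ∣ ≡ ∣ b ∷ [] ∣ * n
∣replicate∣ 0       inside  = refl
∣replicate∣ 0       outside = refl
∣replicate∣ (suc n) inside  = cong suc (∣replicate∣ n inside)
∣replicate∣ (suc n) outside = ∣replicate∣ n outside

-- The subset of Fin w × Fin (suc k), encoded by combine, that meets row 0 in R and every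
-- other row in C.
column : ∀ {w} k → Subset w → Subset w → Fin w → Subset (suc k)
column k R C x = lookup R x ∷ replicate k (lookup C x)

layered : ∀ {w} k → Subset w → Subset w → Subset (w * suc k)
layered k R C = concat (tabulate (column k R C))

module _ {w k : ℕ} (R C : Subset w) where

  lookup-layered : ∀ x y → lookup (layered k R C) (combine x y) ≡ lookup (column k R C x) y
  lookup-layered x y = trans (lookup-concat (tabulate (column k R C)) x y)
                             (cong (λ col → lookup col y) (lookup∘tabulate (column k R C) x))

  combine-zero∈layered⁻ : ∀ {x} → combine x zero ∈ layered k R C → x ∈ R
  combine-zero∈layered⁻ {x} x∈ = lookup⇒[]= x R (trans (sym (lookup-layered x zero)) ([]=⇒lookup x∈))

  combine-suc∈layered⁻ : ∀ {x j} → combine x (suc j) ∈ layered k R C → x ∈ C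
  combine-suc∈layered⁻ {x} {j} x∈ = lookup⇒[]= x C (begin
    lookup C x                                                 ≡⟨ lookup-replicate j (lookup C x) ⟨
    lookup (column k R C x) (suc j)                            ≡⟨ lookup-layered x (suc j) ⟨
    lookup (layered k R C) (combine x (suc j))                 ≡⟨ []=⇒lookup x∈ ⟩
    inside                                                     ∎)
    where open ≡-Reasoning

∣layered∣ : ∀ {w} k (R C : Subset w) → ∣ layered k R C ∣ ≡ ∣ R ∣ + ∣ C ∣ * k
∣layered∣ k []      []      = refl
∣layered∣ k (a ∷ R) (b ∷ C) = begin
  ∣ (a ∷ replicate k b) ++ layered k R C ∣              ≡⟨ ∣p++q∣≡∣p∣+∣q∣ (a ∷ replicate k b) _ ⟩
  ∣ a ∷ replicate k b ∣ + ∣ layered k R C ∣             ≡⟨ cong₂ _+_ head+rest (∣layered∣ k R C) ⟩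
  (∣ a ∷ [] ∣ + ∣ b ∷ [] ∣ * k) + (∣ R ∣ + ∣ C ∣ * k)   ≡⟨ regroup (∣ a ∷ [] ∣) (∣ b ∷ [] ∣) (∣ R ∣) (∣ C ∣) k ⟩
  (∣ a ∷ [] ∣ + ∣ R ∣) + (∣ b ∷ [] ∣ + ∣ C ∣) * k       ≡⟨ cong₂ (λ r c → r + c * k) (∣p++q∣≡∣p∣+∣q∣ (a ∷ []) R) (∣p++q∣≡∣p∣+∣q∣ (b ∷ []) C) ⟨
  ∣ a ∷ R ∣ + ∣ b ∷ C ∣ * k                             ∎
  where
  open ≡-Reasoning
  head+rest : ∣ a ∷ replicate k b ∣ ≡ ∣ a ∷ [] ∣ + ∣ b ∷ [] ∣ * k
  head+rest = trans (∣p++q∣≡∣p∣+∣q∣ (a ∷ []) (replicate k b)) (cong (∣ a ∷ [] ∣ +_) (∣replicate∣ k b))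
  regroup : ∀ a b r c k → (a + b * k) + (r + c * k) ≡ (a + r) + (b + c) * k
  regroup = solve-∀

module PairView {w h : ℕ} (Adj : Fin w × Fin h → Fin w × Fin h → Set) (S : Subset (w * h)) where

  Adj# : Fin (w * h) → Fin (w * h) → Set
  Adj# a b = Adj (remQuot h a) (remQuot h b)

  FilledAt : Fin w × Fin h → Set
  FilledAt p = Filled Adj# S (uncurry combine p)

  filledAt-remQuot : ∀ a → FilledAt (remQuot h a) → Filled Adj# S a
  filledAt-remQuot a = subst (Filled Adj# S) (combine-remQuot {w} h a)

  force-pair : ∀ {p q} → FilledAt p → Adj p q → (∀ r → Adj p r → r ≢ q → FilledAt r) → FilledAt q
  force-pair {x , y} {x' , y'} filled-p p~q others =
    force filled-p (subst₂ Adj (sym (remQuot-combine x y)) (sym (remQuot-combine x' y')) p~q)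
      λ a p~a a≢q → filledAt-remQuot a
        (others (remQuot h a) (subst (λ p → Adj p (remQuot h a)) (remQuot-combine x y) p~a)
                λ a≡q → a≢q (trans (sym (combine-remQuot {w} h a)) (cong (uncurry combine) a≡q)))

  isZeroForcingSet-pair : (∀ p → FilledAt p) → IsZeroForcingSet Adj# S
  isZeroForcingSet-pair filled a = filledAt-remQuot a (filled (remQuot h a))

module HierarchicalCompleteForcing {w k : ℕ} (U : Subset w) {x₀ x₁ : Fin w} (x₀∉U : x₀ ∉ U) (x₁≢x₀ : x₁ ≢ x₀) where

  Unfilled : Subset (w * suc (suc k))
  Unfilled = layered (suc k) (U ∪ ⁅ x₀ ⁆) ⁅ x₁ ⁆

  open PairView (HierAdj (KAdj w) U (KAdj (suc (suc k)))) (∁ Unfilled)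

  filled-∉Unfilled : ∀ {p} → uncurry combine p ∉ Unfilled → FilledAt p
  filled-∉Unfilled p∉ = initial (x∉p⇒x∈∁p p∉)

  filled-upper-≢x₁ : ∀ {x} j → x ≢ x₁ → FilledAt (x , suc j)
  filled-upper-≢x₁ j x≢x₁ = filled-∉Unfilled λ p∈ → x≢x₁ (x∈⁅y⁆⇒x≡y x₁ (combine-suc∈layered⁻ (U ∪ ⁅ x₀ ⁆) ⁅ x₁ ⁆ p∈))

  filled-upper : ∀ x j → FilledAt (x , suc j)
  filled-upper x j with x ≟ x₁
  ... | no x≢x₁ = filled-upper-≢x₁ j x≢x₁
  ... | yes refl = force-pair (filled-upper-≢x₁ j (x₁≢x₀ ∘ sym)) (inj₂ (refl , x₁≢x₀ ∘ sym)) λ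
    { _        (inj₁ (refl , x₀∈U , _)) _ → ⊥-elim (x₀∉U x₀∈U)
    ; (x' , _) (inj₂ (refl , _))       r≢ → filled-upper-≢x₁ j (λ x'≡x₁ → r≢ (cong (_, suc j) x'≡x₁)) }

  filled-root : ∀ {x} → x ∈ U → FilledAt (x , zero)
  filled-root {x} x∈U = force-pair (filled-upper x zero) (inj₁ (refl , x∈U , λ ())) λ
    { (x' , suc j) _                   _  → filled-upper x' j
    ; (x' , zero)  (inj₁ (refl , _))   r≢ → ⊥-elim (r≢ refl)
    ; (x' , zero)  (inj₂ (() , _))     _ }

  filled-base-≢x₀ : ∀ {x} → x ≢ x₀ → FilledAt (x , zero)
  filled-base-≢x₀ {x} x≢x₀ with x ∈? U
  ... | yes x∈U = filled-root x∈U
  ... | no x∉U  = filled-∉Unfilled λ p∈ →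
    [ x∉U , x≢x₀ ∘ x∈⁅y⁆⇒x≡y x₀ ]′ (x∈p∪q⁻ U ⁅ x₀ ⁆ (combine-zero∈layered⁻ (U ∪ ⁅ x₀ ⁆) ⁅ x₁ ⁆ p∈))

  filled-≢x₀-base : ∀ p → p ≢ (x₀ , zero) → FilledAt p
  filled-≢x₀-base (x , suc j) _  = filled-upper x j
  filled-≢x₀-base (x , zero)  p≢ = filled-base-≢x₀ (λ x≡x₀ → p≢ (cong (_, zero) x≡x₀))

  filled : ∀ p → FilledAt p
  filled (x , suc j) = filled-upper x j
  filled (x , zero) with x ≟ x₀
  ... | no x≢x₀ = filled-base-≢x₀ x≢x₀
  ... | yes refl = force-pair (filled-base-≢x₀ x₁≢x₀) (inj₂ (refl , x₁≢x₀)) λ r _ → filled-≢x₀-base r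

  h+∣U∣≤∣Unfilled∣ : suc (suc k) + ∣ U ∣ ≤ ∣ Unfilled ∣
  h+∣U∣≤∣Unfilled∣ = begin
    suc (suc k) + ∣ U ∣                 ≡⟨ cong suc (+-comm (suc k) ∣ U ∣) ⟩
    suc ∣ U ∣ + suc k                   ≤⟨ +-mono-≤ (p⊂q⇒∣p∣<∣q∣ U⊂U∪⁅x₀⁆) (≤-reflexive ∣⁅x₁⁆∣*h≡h) ⟩
    ∣ U ∪ ⁅ x₀ ⁆ ∣ + ∣ ⁅ x₁ ⁆ ∣ * suc k ≡⟨ ∣layered∣ (suc k) (U ∪ ⁅ x₀ ⁆) ⁅ x₁ ⁆ ⟨
    ∣ Unfilled ∣                        ∎
    where
    open ≤-Reasoning
    U⊂U∪⁅x₀⁆ : U ⊂ U ∪ ⁅ x₀ ⁆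
    U⊂U∪⁅x₀⁆ = p⊆p∪q ⁅ x₀ ⁆ , x₀ , x∈p∪q⁺ (inj₂ (x∈⁅x⁆ x₀)) , x₀∉U
    ∣⁅x₁⁆∣*h≡h : suc k ≡ ∣ ⁅ x₁ ⁆ ∣ * suc k
    ∣⁅x₁⁆∣*h≡h = sym (trans (cong (_* suc k) (∣⁅x⁆∣≡1 x₁)) (*-identityˡ (suc k)))

  zeroForcingNumber≤ : ZeroForcingNumber≤ (HierAdjFin (KAdj w) U (KAdj (suc (suc k))))
                                          (w * suc (suc k) ∸ (suc (suc k) + ∣ U ∣))
  zeroForcingNumber≤ = ∁ Unfilled , isZeroForcingSet-pair filled , (begin
    ∣ ∁ Unfilled ∣                 ≡⟨ ∣∁p∣≡n∸∣p∣ Unfilled ⟩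
    w * suc (suc k) ∸ ∣ Unfilled ∣ ≤⟨ ∸-monoʳ-≤ (w * suc (suc k)) h+∣U∣≤∣Unfilled∣ ⟩
    w * suc (suc k) ∸ (suc (suc k) + ∣ U ∣) ∎)
    where open ≤-Reasoning

mainTheorem10 : (w h r : ℕ) → 4 ≤ h → 4 ≤ w → (U : Subset w) → ∣ U ∣ ≡ r → r ≢ w
    → ZeroForcingNumber≤ (HierAdjFin (KAdj w) U (KAdj h)) (w * h ∸ (h + r))
mainTheorem10 (suc (suc _)) (suc (suc k)) _ (s≤s (s≤s _)) (s≤s (s≤s _)) U refl ∣U∣≢w
  with ∣p∣≢n⇒∃∉p U ∣U∣≢w
... | x₀ , x₀∉U = zeroForcingNumber≤
  where open HierarchicalCompleteForcing {k = k} U x₀∉U (punchInᵢ≢i x₀ zero)
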